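{- Let $G$ be a finite graph with edge set $E(G)$ and let $\lambda\in\mathbb{N}^{E(G)}$. Then $M(G)_\lambda=M(G_\lambda)$.
   Context: $\mathbb{N}$ denotes the positive integers. For a graph $G$ (finite, undirected, multigraph), $M(G)$ is its cycle (graphic) matroid on $E(G)$. The metric graph $G_\lambda$ is obtained from $G$ by replacing each edge $e$ by a path of length $\lambda(e)$. Metric matroid: for a matroid $M$ on $E$ and $\lambda\in\mathbb{N}^E$, choose pairwise disjoint sets $E_e$ with $\#E_e=\lambda(e)$ and $e\in E_e$, put $E(M_\lambda)=\bigsqcup_e E_e$; the bases of $M_\lambda$ are the sets $E(M_\lambda)\setminus\{x_e:e\notin B'\}$ where $B'$ is a basis of $M$ and $x_e\in E_e$ for each $e\notin B'$. The equality is with the ground set $E_e$ identified with the set of edges of the path replacing $e$. -}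

module Defs where

open import Data.Nat using (ℕ; zero; suc; _<_; _∸_; _≤_)
open import Data.Nat.Properties using (_<?_)
open import Data.Fin using (Fin; toℕ; fromℕ<)
open import Data.Bool using (Bool; true; false)
open import Data.Product using (Σ; Σ-syntax; ∃; ∃-syntax; _×_; _,_; proj₁; proj₂)
open import Data.Sum using (_⊎_; inj₁; inj₂)
open import Data.List using (List; []; _∷_)
open import Data.List.Relation.Unary.All using (All)
open import Data.List.Relation.Unary.Unique.Propositional using (Unique)
open import Relation.Binary.PropositionalEquality using (_≡_; _≢_)
open import Relation.Nullary using (¬_; yes; no)

-- A (finite, undirected) multigraph: vertex type, edge type, and for every
-- edge its (unordered) pair of endpoints, given as an ordered pair that is
-- read in both directions.  Loops (ends e = (v , v)) and parallel edges allowed.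
record Graph : Set₁ where
  constructor mkGraph
  field
    V    : Set
    E    : Set
    ends : E → V × V

open Graph public

finGraph : (n m : ℕ) → (Fin m → Fin n × Fin n) → Graph
finGraph n m en = mkGraph (Fin n) (Fin m) en

Joins : (G : Graph) → E G → V G → V G → Set
Joins G e u v = (ends G e ≡ (u , v)) ⊎ (ends G e ≡ (v , u))

data Walk (G : Graph) : V G → V G → Set where
  nil  : (v : V G) → Walk G v v
  cons : {u v w : V G} (e : E G) → Joins G e u v → Walk G v w → Walk G u w

walkEdges : {G : Graph} {u w : V G} → Walk G u w → List (E G)
walkEdges (nil v)       = []
walkEdges (cons e _ ws) = e ∷ walkEdges ws

EdgeSet : Graph → Set
EdgeSet G = E G → Bool

_⊆_ : {A : Set} → (A → Bool) → (A → Bool) → Set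
S ⊆ T = ∀ a → S a ≡ true → T a ≡ true

HasCycle : (G : Graph) → EdgeSet G → Set
HasCycle G F =
  Σ[ v ∈ V G ] Σ[ w ∈ Walk G v v ]
    (walkEdges w ≢ []) × Unique (walkEdges w) × All (λ e → F e ≡ true) (walkEdges w)

-- Independent sets of the cycle matroid M(G): forests (acyclic edge sets).
IsForest : (G : Graph) → EdgeSet G → Set
IsForest G F = ¬ HasCycle G F

CycleMatroidBasis : (G : Graph) → EdgeSet G → Set
CycleMatroidBasis G B =
  IsForest G B × (∀ F → IsForest G F → B ⊆ F → F ⊆ B)

-- Bases of the metric matroid M_λ, for a matroid M on ground set E given by
-- its family of bases.  We take E_e = {e} × Fin (λ e) (e identified with (e , 0)),
-- so E(M_λ) = Σ E (Fin ∘ λ).  A set S is a basis iff S = E(M_λ) ∖ {x_e : e ∉ B'}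
-- for some basis B' of M and choice x_e ∈ E_e for each e ∉ B'.
MetricBasis : {E : Set} → ((E → Bool) → Set) → (len : E → ℕ) →
              (Σ E (λ e → Fin (len e)) → Bool) → Set
MetricBasis {E} isBasis len S =
  Σ[ B' ∈ (E → Bool) ] isBasis B' ×
  Σ[ x ∈ ((e : E) → B' e ≡ false → Fin (len e)) ]
    (∀ e (j : Fin (len e)) →
       (S (e , j) ≡ false → Σ[ p ∈ B' e ≡ false ] x e p ≡ j) ×
       (Σ[ p ∈ B' e ≡ false ] x e p ≡ j → S (e , j) ≡ false))

-- Metric graph G_λ: edge e with ends (u , v) is replaced by a path
-- u = p₀ , p₁ , … , p_{λ e} = v of length λ e; the internal vertices
-- p₁ … p_{λ e - 1} are new vertices (e , i) with i : Fin (λ e ∸ 1), and the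
-- j-th edge (e , j), j : Fin (λ e), joins p_j and p_{j+1}.
private
  lem : ∀ {i k} → suc i < k → i < k ∸ 1
  lem {i} {suc k} (Data.Nat.s≤s p) = p

metricVertex : (G : Graph) (len : E G → ℕ) (e : E G) → ℕ →
               V G ⊎ Σ (E G) (λ e → Fin (len e ∸ 1))
metricVertex G len e zero = inj₁ (proj₁ (ends G e))
metricVertex G len e (suc i) with suc i <? len e
... | yes p = inj₂ (e , fromℕ< (lem p))
... | no _  = inj₁ (proj₂ (ends G e))

metricGraph : (G : Graph) → (E G → ℕ) → Graph
metricGraph G len =
  mkGraph (V G ⊎ Σ (E G) (λ e → Fin (len e ∸ 1)))
          (Σ (E G) (λ e → Fin (len e)))
          (λ { (e , j) → metricVertex G len e (toℕ j) , metricVertex G len e (suc (toℕ j)) })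

-- Call fullEdges T the set of edges e of G whose whole path E_e lies in T.  A cycle of G
-- through full edges subdivides into a cycle of G_λ inside T.  Conversely, take a cycle of G_λ
-- in T through a piece (e , j).  If e is full, the rest of E_e closes the cycle into a walk
-- between the ends of e, and that walk projects to a walk of G through full edges other than e.
-- If T misses another piece (e , k), the pieces j and k cut E_e and the cycle cannot close.
-- So T is independent in M(G_λ) iff fullEdges T is a forest of G.  Finally, for any
-- down-closed family I, the maximal T with fullEdges T ∈ I are exactly the sets obtained from
-- a maximal B ∈ I by deleting one piece x_e of E_e for every e ∉ B.
module Submission where

open import Defs
open import Data.Bool using (Bool; true; false; _∨_)
open import Data.Bool.Properties using (¬-not; not-¬; T-≡; T-not-≡) renaming (_≟_ to _≟ᵇ_)
open import Data.Empty using (⊥; ⊥-elim)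
open import Data.Fin using (Fin; toℕ; fromℕ<) renaming (_≟_ to _≟ᶠ_)
open import Data.Fin.Properties using (all?; ¬∀⟶∃¬; toℕ<n; toℕ-fromℕ<; toℕ-injective; <-cmp)
open import Data.Nat using (ℕ; zero; suc; _≤_; _<_; _≤′_; ≤′-refl; ≤′-step; z≤n; s≤s; s≤s⁻¹)
open import Data.Nat.Properties using (_<?_; ≤-refl; ≤-reflexive; <⇒≤; <⇒≢; n≮n; m≤n⇒m≤1+n; ≤⇒≤′; ≤′⇒≤; ≤-antisym; ≮⇒≥; ≤-trans; <⇒≱; ≤∧≢⇒<; m<n⇒m<1+n; m<1+n⇒m<n∨m≡n; m≤n⇒m<n∨m≡n)
open import Data.List.Relation.Unary.All as All using (All; []; _∷_)
open import Data.List.Relation.Unary.All.Properties using (¬Any⇒All¬)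
open import Data.List.Relation.Unary.Any using (here; there; any?)
open import Data.List.Relation.Unary.AllPairs using ([]; _∷_)
open import Data.List.Relation.Unary.Unique.Propositional using (Unique)
open import Data.List.Membership.Propositional using (_∈_)
open import Data.Product using (Σ; Σ-syntax; ∃; ∃-syntax; _×_; _,_; proj₁; proj₂; map₁)
open import Data.Product.Properties using (≡-dec; ,-injectiveˡ; ,-injectiveʳ-UIP)
open import Data.Sum as Sum using (_⊎_; inj₁; inj₂; [_,_]′)
open import Function using (_∘_)
open import Function.Bundles using (_⇔_; mk⇔; Equivalence)
import Function.Properties.Equivalence as ⇔
open import Relation.Binary.Definitions using (DecidableEquality; tri<; tri≈; tri>)
open import Axiom.UniquenessOfIdentityProofs.WithK using (uip)
open import Relation.Binary.PropositionalEquality using (_≡_; _≢_; refl; sym; trans; cong; subst)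
open import Relation.Nullary using (¬_; yes; no; does)
open import Relation.Nullary.Decidable using (isYes; toWitness; toWitnessFalse; fromWitness; fromWitnessFalse)

data WalkIn (G : Graph) (P : E G → Set) : V G → V G → Set where
  nil  : (v : V G) → WalkIn G P v v
  cons : {u v w : V G} (f : E G) → P f → Joins G f u v → WalkIn G P v w → WalkIn G P u w

Invariant : (G : Graph) → (E G → Set) → (V G → Set) → Set
Invariant G P Q = ∀ f → P f → Q (proj₁ (ends G f)) ⇔ Q (proj₂ (ends G f))

module _ {G : Graph} where

  Joins-sym : ∀ {f u v} → Joins G f u v → Joins G f v u
  Joins-sym (inj₁ eq) = inj₂ eq
  Joins-sym (inj₂ eq) = inj₁ eq

  _++ʷ_ : ∀ {P u v w} → WalkIn G P u v → WalkIn G P v w → WalkIn G P u w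
  nil _           ++ʷ q = q
  cons f p j r    ++ʷ q = cons f p j (r ++ʷ q)

  reverseʷ : ∀ {P u v} → WalkIn G P u v → WalkIn G P v u
  reverseʷ (nil v)         = nil v
  reverseʷ (cons f p j r) = reverseʷ r ++ʷ cons f p (Joins-sym j) (nil _)

  Invariant-walk : ∀ {P Q u v} → Invariant G P Q → WalkIn G P u v → Q u → Q v
  Invariant-walk inv (nil v) q = q
  Invariant-walk inv (cons f p (inj₁ refl) r) q = Invariant-walk inv r (Equivalence.to (inv f p) q)
  Invariant-walk inv (cons f p (inj₂ refl) r) q = Invariant-walk inv r (Equivalence.from (inv f p) q)

  fromWalk : ∀ {P u v} (w : Walk G u v) → All P (walkEdges w) → WalkIn G P u v
  fromWalk (nil v)       []       = nil v
  fromWalk (cons e j w) (p ∷ ps) = cons e p j (fromWalk w ps)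

  HasCycle-mono : ∀ {F F′} → F ⊆ F′ → HasCycle G F → HasCycle G F′
  HasCycle-mono F⊆F′ (v , w , w≢[] , uniq , inF) = v , w , w≢[] , uniq , All.map (λ {e} → F⊆F′ e) inF

  IsForest-antitone : ∀ {F F′} → F ⊆ F′ → IsForest G F′ → IsForest G F
  IsForest-antitone F⊆F′ forest = forest ∘ HasCycle-mono F⊆F′

  Trail : (E G → Set) → V G → V G → Set
  Trail P u v = Σ[ w ∈ Walk G u v ] Unique (walkEdges w) × All P (walkEdges w)

  Joins-endpoint : ∀ {f a v u q} → Joins G f a v → Joins G f u q → (q ≡ a) ⊎ Joins G f a q
  Joins-endpoint (inj₁ refl) (inj₁ refl) = inj₂ (inj₁ refl)
  Joins-endpoint (inj₁ refl) (inj₂ refl) = inj₁ refl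
  Joins-endpoint (inj₂ refl) (inj₁ refl) = inj₁ refl
  Joins-endpoint (inj₂ refl) (inj₂ refl) = inj₂ (inj₂ refl)

  suffixAfter : ∀ {P a b f} (t : Walk G a b) → f ∈ walkEdges t → Unique (walkEdges t) → All P (walkEdges t) →
                Σ[ q ∈ V G ] Σ[ u ∈ V G ] Joins G f u q ×
                  Σ[ t′ ∈ Trail P q b ] All (f ≢_) (walkEdges (proj₁ t′))
  suffixAfter (cons g j t) (here refl) (g∉t ∷ uniq) (_ ∷ inP) = _ , _ , j , (t , uniq , inP) , g∉t
  suffixAfter (cons g j t) (there f∈t) (_ ∷ uniq)  (_ ∷ inP) = suffixAfter t f∈t uniq inP

  -- A repeated edge is cut out by jumping to its last occurrence, so no equality test on
  -- vertices is needed.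
  toTrail : ∀ {P u v} → DecidableEquality (E G) → WalkIn G P u v → Trail P u v
  toTrail _≟_ (nil v) = nil v , [] , []
  toTrail _≟_ (cons f p j r) with toTrail _≟_ r
  ... | t , uniq , inP with any? (f ≟_) (walkEdges t)
  ...   | no f∉t = cons f j t , ¬Any⇒All¬ _ f∉t ∷ uniq , p ∷ inP
  ...   | yes f∈t with suffixAfter t f∈t uniq inP
  ...     | _ , _ , j′ , (t′ , uniq′ , inP′) , f∉t′ with Joins-endpoint j j′
  ...       | inj₁ refl = t′ , uniq′ , inP′
  ...       | inj₂ j″  = cons f j″ t′ , f∉t′ ∷ uniq′ , p ∷ inP′

_∖_ : {A : Set} → (A → Bool) → A → A → Set
(F ∖ f) g = F g ≡ true × f ≢ g

OnCycle : (G : Graph) → EdgeSet G → E G → Set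
OnCycle G F f = F f ≡ true × WalkIn G (F ∖ f) (proj₂ (ends G f)) (proj₁ (ends G f))

module _ {G : Graph} where

  HasCycle⇒OnCycle : ∀ {F} → HasCycle G F → ∃ (OnCycle G F)
  HasCycle⇒OnCycle (_ , nil _ , w≢[] , _ , _) = ⊥-elim (w≢[] refl)
  HasCycle⇒OnCycle (_ , cons f j w , _ , (f∉w ∷ _) , (Ff ∷ inF)) with j
  ... | inj₁ refl = f , Ff , fromWalk w (All.zip (inF , f∉w))
  ... | inj₂ refl = f , Ff , reverseʷ (fromWalk w (All.zip (inF , f∉w)))

  OnCycle⇒HasCycle : ∀ {F f} → DecidableEquality (E G) → OnCycle G F f → HasCycle G F
  OnCycle⇒HasCycle _≟_ (Ff , W) with toTrail _≟_ W
  ... | t , uniq , inP =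
    _ , cons _ (inj₁ refl) t , (λ ()) , (proj₂ (All.unzip inP) ∷ uniq) , (Ff ∷ proj₁ (All.unzip inP))

Maximal : {A : Set} → ((A → Bool) → Set) → (A → Bool) → Set
Maximal I B = I B × (∀ F → I F → B ⊆ F → F ⊆ B)

Maximal-cong : {A : Set} {I J : (A → Bool) → Set} → (∀ S → I S ⇔ J S) → ∀ S → Maximal I S ⇔ Maximal J S
Maximal-cong I⇔J S = mk⇔ (λ { (IS , max) → to (I⇔J S) IS , λ F JF → max F (from (I⇔J F) JF) })
                         (λ { (JS , max) → from (I⇔J S) JS , λ F IF → max F (to (I⇔J F) IF) })
  where open Equivalence

module _ {A : Set} (_≟_ : DecidableEquality A) where

  insert : A → (A → Bool) → A → Bool
  insert a S b = does (b ≟ a) ∨ S b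

  insert-self : ∀ a S → insert a S a ≡ true
  insert-self a S with a ≟ a
  ... | yes _  = refl
  ... | no a≢a = ⊥-elim (a≢a refl)

  ⊆-insert : ∀ a S → S ⊆ insert a S
  ⊆-insert a S b Sb with b ≟ a
  ... | yes _ = refl
  ... | no _  = Sb

  insert⁻ : ∀ a S b → insert a S b ≡ true → b ≡ a ⊎ S b ≡ true
  insert⁻ a S b h with b ≟ a
  ... | yes b≡a = inj₁ b≡a
  ... | no _    = inj₂ h

  Maximal-insert : ∀ {I S} a → Maximal I S → I (insert a S) → S a ≡ true
  Maximal-insert {S = S} a (_ , max) I[a∪S] = max _ I[a∪S] (⊆-insert a S) a (insert-self a S)

fullEdges : {E : Set} (len : E → ℕ) → (Σ E (λ e → Fin (len e)) → Bool) → E → Bool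
fullEdges len T e = isYes (all? λ j → T (e , j) ≟ᵇ true)

module _ {E : Set} {len : E → ℕ} (T : Σ E (λ e → Fin (len e)) → Bool) {e : E} where

  fullEdges-true⁻ : fullEdges len T e ≡ true → ∀ j → T (e , j) ≡ true
  fullEdges-true⁻ h = toWitness (Equivalence.from T-≡ h)

  fullEdges-true⁺ : (∀ j → T (e , j) ≡ true) → fullEdges len T e ≡ true
  fullEdges-true⁺ all = Equivalence.to T-≡ (fromWitness all)

  fullEdges-false⁻ : fullEdges len T e ≡ false → ∃[ j ] T (e , j) ≡ false
  fullEdges-false⁻ h with ¬∀⟶∃¬ (len e) _ (λ j → T (e , j) ≟ᵇ true) (toWitnessFalse (Equivalence.from T-not-≡ h))
  ... | j , Tj≢true = j , ¬-not Tj≢true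

  fullEdges-false⁺ : ∀ {j} → T (e , j) ≡ false → fullEdges len T e ≡ false
  fullEdges-false⁺ Tj =
    Equivalence.to T-not-≡ (fromWitnessFalse (λ all → not-¬ (all _) Tj))

module MetricMatroid {E : Set} (_≟_ : DecidableEquality E) (len : E → ℕ)
                     (I : (E → Bool) → Set) (I-antitone : ∀ {F F′} → F ⊆ F′ → I F′ → I F) where

  E′ : Set
  E′ = Σ E (λ e → Fin (len e))

  _≟′_ : DecidableEquality E′
  _≟′_ = ≡-dec _≟_ _≟ᶠ_

  insert′ : E′ → (E′ → Bool) → E′ → Bool
  insert′ = insert _≟′_

  fullEdges-insert : ∀ {a k} S {e} → fullEdges len (insert′ (a , k) S) e ≡ true → a ≢ e → fullEdges len S e ≡ true
  fullEdges-insert {a} {k} S {e} h a≢e =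
    fullEdges-true⁺ S λ j → S[e,j] j (insert⁻ _≟′_ (a , k) S (e , j) (fullEdges-true⁻ (insert′ (a , k) S) h j))
    where
      S[e,j] : ∀ j → (e , j) ≡ (a , k) ⊎ S (e , j) ≡ true → S (e , j) ≡ true
      S[e,j] j (inj₁ refl) = ⊥-elim (a≢e refl)
      S[e,j] j (inj₂ Sej)  = Sej

  metricBasis⇒maximal : ∀ S → MetricBasis (Maximal I) len S → Maximal (I ∘ fullEdges len) S
  metricBasis⇒maximal S (B , (IB , maxB) , x , cond) = I-antitone full⊆B IB , maximal
    where
      dropped : ∀ {e} (p : B e ≡ false) → S (e , x e p) ≡ false
      dropped p = proj₂ (cond _ _) (p , refl)

      onlyDropped : ∀ {e} (p : B e ≡ false) {j} → S (e , j) ≡ false → x e p ≡ j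
      onlyDropped p {j} Sej with proj₁ (cond _ j) Sej
      ... | p′ , refl = cong (x _) (uip p p′)

      kept : ∀ {e} → B e ≡ true → ∀ j → S (e , j) ≡ true
      kept Be j = ¬-not λ Sej → not-¬ Be (proj₁ (proj₁ (cond _ j) Sej))

      full⊆B : fullEdges len S ⊆ B
      full⊆B e full with B e in Be
      ... | true  = refl
      ... | false = ⊥-elim (not-¬ (fullEdges-true⁻ S full (x e Be)) (dropped Be))

      maximal : ∀ F → I (fullEdges len F) → S ⊆ F → F ⊆ S
      maximal F IF S⊆F (e , j) Fej with S (e , j) in Sej
      ... | true  = refl
      ... | false = ⊥-elim (not-¬ (Maximal-insert _≟_ e (IB , maxB) (I-antitone e∪B⊆full IF)) Be)
        where
          Be : B e ≡ false
          Be = proj₁ (proj₁ (cond e j) Sej)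
          F[e,i] : ∀ i → F (e , i) ≡ true
          F[e,i] i with i ≟ᶠ j
          ... | yes refl = Fej
          ... | no i≢j   = S⊆F _ (¬-not λ Sei → i≢j (trans (sym (onlyDropped Be Sei)) (onlyDropped Be Sej)))
          e∪B⊆full : insert _≟_ e B ⊆ fullEdges len F
          e∪B⊆full e′ h with insert⁻ _≟_ e B e′ h
          ... | inj₁ refl = fullEdges-true⁺ F F[e,i]
          ... | inj₂ Be′  = fullEdges-true⁺ F λ i → S⊆F _ (kept Be′ i)

  maximal⇒metricBasis : ∀ S → Maximal (I ∘ fullEdges len) S → MetricBasis (Maximal I) len S
  maximal⇒metricBasis S (IS , maxS) = fullEdges len S , (IS , maximal) , x , cond
    where
      x : ∀ e → fullEdges len S e ≡ false → Fin (len e)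
      x e p = proj₁ (fullEdges-false⁻ S p)

      maximal : ∀ F → I F → fullEdges len S ⊆ F → F ⊆ fullEdges len S
      maximal F IF full⊆F a Fa with fullEdges len S a in notFull
      ... | true  = refl
      ... | false = ⊥-elim (not-¬ (Maximal-insert _≟′_ (a , k) (IS , maxS) (I-antitone full[ak∪S]⊆F IF)) Sak)
        where
          k = proj₁ (fullEdges-false⁻ S notFull)
          Sak = proj₂ (fullEdges-false⁻ S notFull)
          full[ak∪S]⊆F : fullEdges len (insert′ (a , k) S) ⊆ F
          full[ak∪S]⊆F e h with a ≟ e
          ... | yes refl = Fa
          ... | no a≢e   = full⊆F e (fullEdges-insert S h a≢e)

      droppedUnique : ∀ {e j} → S (e , j) ≡ false → Σ[ p ∈ fullEdges len S e ≡ false ] x e p ≡ j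
      droppedUnique {e} {j} Sej = p , unique
        where
          p = fullEdges-false⁺ S Sej
          k = x e p
          Sek = proj₂ (fullEdges-false⁻ S p)

          full[ej∪S]⊆full : k ≢ j → fullEdges len (insert′ (e , j) S) ⊆ fullEdges len S
          full[ej∪S]⊆full k≢j e′ h with e ≟ e′
          ... | no e≢e′  = fullEdges-insert S h e≢e′
          ... | yes refl with insert⁻ _≟′_ (e , j) S (e , k) (fullEdges-true⁻ (insert′ (e , j) S) h k)
          ...   | inj₁ ek≡ej = ⊥-elim (k≢j (,-injectiveʳ-UIP uip ek≡ej))
          ...   | inj₂ Sek′  = ⊥-elim (not-¬ Sek′ Sek)

          unique : k ≡ j
          unique with k ≟ᶠ j
          ... | yes k≡j = k≡j
          ... | no k≢j  =
            ⊥-elim (not-¬ (Maximal-insert _≟′_ (e , j) (IS , maxS) (I-antitone (full[ej∪S]⊆full k≢j) IS)) Sej)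

      cond : ∀ e j → (S (e , j) ≡ false → Σ[ p ∈ fullEdges len S e ≡ false ] x e p ≡ j)
                   × (Σ[ p ∈ fullEdges len S e ≡ false ] x e p ≡ j → S (e , j) ≡ false)
      cond e j = droppedUnique , λ { (p , refl) → proj₂ (fullEdges-false⁻ S p) }

  metricBasis⇔maximal : ∀ S → MetricBasis (Maximal I) len S ⇔ Maximal (I ∘ fullEdges len) S
  metricBasis⇔maximal S = mk⇔ (metricBasis⇒maximal S) (maximal⇒metricBasis S)

module MetricGraph (G : Graph) (_≟_ : DecidableEquality (E G)) (len : E G → ℕ) (len≥1 : ∀ e → 1 ≤ len e) where

  Gλ : Graph
  Gλ = metricGraph G len

  _≟λ_ : DecidableEquality (E Gλ)
  _≟λ_ = ≡-dec _≟_ _≟ᶠ_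

  start end : E G → V G
  start e = proj₁ (ends G e)
  end   e = proj₂ (ends G e)

  vertexAt : E G → ℕ → V Gλ
  vertexAt = metricVertex G len

  vertexAt-beyond : ∀ e t → ¬ t < len e → vertexAt e t ≡ inj₁ (end e)
  vertexAt-beyond e zero    t≮len = ⊥-elim (t≮len (len≥1 e))
  vertexAt-beyond e (suc t) t≮len with suc t <? len e
  ... | yes t<len = ⊥-elim (t≮len t<len)
  ... | no _      = refl

  segment : ∀ {P} e {a b} → a ≤ b → b ≤ len e → (∀ i → a ≤ toℕ i → toℕ i < b → P (e , i)) →
            WalkIn Gλ P (vertexAt e a) (vertexAt e b)
  segment {P} e {a} a≤b = go (≤⇒≤′ a≤b)
    where
      go : ∀ {b} → a ≤′ b → b ≤ len e → (∀ i → a ≤ toℕ i → toℕ i < b → P (e , i)) →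
           WalkIn Gλ P (vertexAt e a) (vertexAt e b)
      go ≤′-refl _ _ = nil _
      go (≤′-step {b} a≤′b) b<len inP =
        go a≤′b (<⇒≤ b<len) (λ i a≤i i<b → inP i a≤i (m≤n⇒m≤1+n i<b)) ++ʷ cons (e , i) Pi joins (nil _)
        where
          i = fromℕ< b<len
          i≡b = toℕ-fromℕ< b<len
          Pi = inP i (subst (a ≤_) (sym i≡b) (≤′⇒≤ a≤′b)) (s≤s (≤-reflexive i≡b))
          joins : Joins Gλ (e , i) (vertexAt e b) (vertexAt e (suc b))
          joins = inj₁ (cong (λ t → vertexAt e t , vertexAt e (suc t)) i≡b)

  segmentToEnd : ∀ {P} e {a} → a ≤ len e → (∀ i → a ≤ toℕ i → P (e , i)) →
                 WalkIn Gλ P (vertexAt e a) (inj₁ (end e))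
  segmentToEnd {P} e a≤len inP =
    subst (WalkIn Gλ P _) (vertexAt-beyond e (len e) (n≮n (len e))) (segment e a≤len ≤-refl (λ i a≤i _ → inP i a≤i))

  restOfEdge : ∀ {P} e j → (∀ i → j ≢ i → P (e , i)) →
               WalkIn Gλ P (vertexAt e (suc (toℕ j))) (inj₁ (end e)) × WalkIn Gλ P (inj₁ (start e)) (vertexAt e (toℕ j))
  restOfEdge e j inP =
    segmentToEnd e (toℕ<n j) (λ i j<i → inP i λ j≡i → <⇒≢ j<i (cong toℕ j≡i)) ,
    segment e z≤n (<⇒≤ (toℕ<n j)) (λ i _ i<j → inP i λ j≡i → <⇒≢ i<j (cong toℕ (sym j≡i)))

  subdivide : ∀ {PG P u v} → (∀ e → PG e → ∀ i → P (e , i)) → WalkIn G PG u v → WalkIn Gλ P (inj₁ u) (inj₁ v)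
  subdivide inP (nil v)                  = nil _
  subdivide inP (cons e p (inj₁ refl) r) = wholeEdge ++ʷ subdivide inP r
    where wholeEdge = segmentToEnd e z≤n (λ i _ → inP e p i)
  subdivide inP (cons e p (inj₂ refl) r) = reverseʷ wholeEdge ++ʷ subdivide inP r
    where wholeEdge = segmentToEnd e z≤n (λ i _ → inP e p i)

  -- A predicate on the vertices of Gλ, given by Q₀ on the old vertices and by R e t on the
  -- vertex at distance t along e.
  module Lift (Q₀ : V G → Set) (R : E G → ℕ → Set)
              (R-start : ∀ e → R e 0 ⇔ Q₀ (start e)) (R-end : ∀ e → R e (len e) ⇔ Q₀ (end e)) where

    Q : V Gλ → Set
    Q (inj₁ v)       = Q₀ v
    Q (inj₂ (e , i)) = R e (suc (toℕ i))

    Q-vertexAt : ∀ e t → t ≤ len e → Q (vertexAt e t) ⇔ R e t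
    Q-vertexAt e zero    _     = ⇔.sym (R-start e)
    Q-vertexAt e (suc t) t≤len with suc t <? len e
    ... | yes t<len = subst (λ s → R e (suc s) ⇔ R e (suc t)) (sym (toℕ-fromℕ< _)) ⇔.refl
    ... | no  t≮len = subst (λ s → Q₀ (end e) ⇔ R e s) (≤-antisym (≮⇒≥ t≮len) t≤len) (⇔.sym (R-end e))

    Q-invariant : ∀ {P} → (∀ e i → P (e , i) → R e (toℕ i) ⇔ R e (suc (toℕ i))) → Invariant Gλ P Q
    Q-invariant step (e , i) p =
      ⇔.trans (Q-vertexAt e (toℕ i) (<⇒≤ (toℕ<n i)))
              (⇔.trans (step e i p) (⇔.sym (Q-vertexAt e (suc (toℕ i)) (toℕ<n i))))

  Before After : (E Gλ → Set) → E G → ℕ → Set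
  Before P e t = ∀ i → toℕ i < t → P (e , i)
  After  P e t = ∀ i → t ≤ toℕ i → P (e , i)

  Before-step : ∀ {P e i} → P (e , i) → Before P e (toℕ i) ⇔ Before P e (suc (toℕ i))
  Before-step {P} {e} {i} p = mk⇔
    (λ before k k<1+i → [ before k , (λ k≡i → subst (λ k → P (e , k)) (sym (toℕ-injective k≡i)) p) ]′
                          (m<1+n⇒m<n∨m≡n k<1+i))
    (λ before k k<i → before k (m<n⇒m<1+n k<i))

  After-step : ∀ {P e i} → P (e , i) → After P e (toℕ i) ⇔ After P e (suc (toℕ i))
  After-step {P} {e} {i} p = mk⇔
    (λ after k 1+i≤k → after k (<⇒≤ 1+i≤k))
    (λ after k i≤k → [ after k , (λ i≡k → subst (λ k → P (e , k)) (toℕ-injective i≡k) p) ]′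
                       (m≤n⇒m<n∨m≡n i≤k))

  project : ∀ {P PG u v} → (∀ e → (∀ i → P (e , i)) → PG e) → WalkIn Gλ P (inj₁ u) (inj₁ v) → WalkIn G PG u v
  project {P} {PG} {u} collapse W = Invariant-walk {Q = Q} (Q-invariant step) W (nil u)
    where
      Q₀ : V G → Set
      Q₀ = WalkIn G PG u

      -- The vertex at distance t along e is reachable from u through the part of e that P
      -- covers between it and an endpoint of e reachable from u.
      R : E G → ℕ → Set
      R e t = (Before P e t × Q₀ (start e)) ⊎ (After P e t × Q₀ (end e))

      R-start : ∀ e → R e 0 ⇔ Q₀ (start e)
      R-start e = mk⇔
        [ proj₂ , (λ { (after , q) → q ++ʷ cons e (collapse e λ i → after i z≤n) (inj₂ refl) (nil _) }) ]′
        (λ q → inj₁ ((λ _ ()) , q))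

      R-end : ∀ e → R e (len e) ⇔ Q₀ (end e)
      R-end e = mk⇔
        [ (λ { (before , q) → q ++ʷ cons e (collapse e λ i → before i (toℕ<n i)) (inj₁ refl) (nil _) }) , proj₂ ]′
        (λ q → inj₂ ((λ i len≤i → ⊥-elim (<⇒≱ (toℕ<n i) len≤i)) , q))

      step : ∀ e i → P (e , i) → R e (toℕ i) ⇔ R e (suc (toℕ i))
      step e i p = mk⇔ (Sum.map (map₁ (to (Before-step {P} p)))   (map₁ (to (After-step {P} p))))
                       (Sum.map (map₁ (from (Before-step {P} p))) (map₁ (from (After-step {P} p))))
        where open Equivalence

      open Lift Q₀ R R-start R-end

  trapped : ∀ {P} e (lo hi : Fin (len e)) → ¬ P (e , lo) → ¬ P (e , hi) →
            ∀ a b → WalkIn Gλ P (vertexAt e a) (vertexAt e b) → b ≤ len e →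
            toℕ lo < a → a ≤ toℕ hi → toℕ lo < b × b ≤ toℕ hi
  trapped {P} e lo hi ¬Plo ¬Phi a b W b≤len lo<a a≤hi =
    proj₂ (to (Q-vertexAt e b b≤len)
              (Invariant-walk {Q = Q} (Q-invariant step) W (from (Q-vertexAt e a a≤len) (refl , lo<a , a≤hi))))
    where
      open Equivalence
      a≤len = ≤-trans a≤hi (<⇒≤ (toℕ<n hi))

      -- Without the pieces lo and hi, the inner vertices of e between them form a component.
      R : E G → ℕ → Set
      R e′ t = e′ ≡ e × toℕ lo < t × t ≤ toℕ hi

      R-start : ∀ e′ → R e′ 0 ⇔ ⊥
      R-start e′ = mk⇔ (λ { (_ , () , _) }) ⊥-elim

      R-end : ∀ e′ → R e′ (len e′) ⇔ ⊥
      R-end e′ = mk⇔ (λ { (refl , _ , len≤hi) → <⇒≱ (toℕ<n hi) len≤hi }) ⊥-elim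

      step : ∀ e′ i → P (e′ , i) → R e′ (toℕ i) ⇔ R e′ (suc (toℕ i))
      step e′ i p = mk⇔
        (λ { (refl , lo<i , i≤hi) →
               refl , m<n⇒m<1+n lo<i , ≤∧≢⇒< i≤hi (λ i≡hi → ¬Phi (subst (λ k → P (e , k)) (toℕ-injective i≡hi) p)) })
        (λ { (refl , lo<1+i , 1+i≤hi) →
               refl , ≤∧≢⇒< (s≤s⁻¹ lo<1+i) (λ lo≡i → ¬Plo (subst (λ k → P (e , k)) (sym (toℕ-injective lo≡i)) p))
                    , <⇒≤ 1+i≤hi })

      open Lift (λ _ → ⊥) R R-start R-end

  HasCycle-subdivide : ∀ T → HasCycle G (fullEdges len T) → HasCycle Gλ T
  HasCycle-subdivide T cycle with HasCycle⇒OnCycle cycle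
  ... | e , full , W =
    OnCycle⇒HasCycle _≟λ_ (fullEdges-true⁻ T full j , proj₁ rest ++ʷ (subdivide refine W ++ʷ proj₂ rest))
    where
      j = fromℕ< (len≥1 e)
      rest = restOfEdge e j (λ i j≢i → fullEdges-true⁻ T full i , j≢i ∘ ,-injectiveʳ-UIP uip)
      refine : ∀ e′ → (fullEdges len T ∖ e) e′ → ∀ i → (T ∖ (e , j)) (e′ , i)
      refine e′ (full′ , e≢e′) i = fullEdges-true⁻ T full′ i , e≢e′ ∘ ,-injectiveˡ

  HasCycle-project : ∀ T → HasCycle Gλ T → HasCycle G (fullEdges len T)
  HasCycle-project T cycle with HasCycle⇒OnCycle cycle
  ... | (e , j) , Tej , W with fullEdges len T e in full
  ...   | true =
    OnCycle⇒HasCycle _≟_ (full , project collapse (reverseʷ (proj₁ rest) ++ʷ (W ++ʷ reverseʷ (proj₂ rest))))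
    where
      rest = restOfEdge e j (λ i j≢i → fullEdges-true⁻ T full i , j≢i ∘ ,-injectiveʳ-UIP uip)
      collapse : ∀ e′ → (∀ i → (T ∖ (e , j)) (e′ , i)) → (fullEdges len T ∖ e) e′
      collapse e′ all = fullEdges-true⁺ T (proj₁ ∘ all) , λ { refl → proj₂ (all j) refl }
  ...   | false = ⊥-elim (cut (fullEdges-false⁻ T full))
    where
      removed : ¬ (T ∖ (e , j)) (e , j)
      removed (_ , j≢j) = j≢j refl
      missing : ∀ {k} → T (e , k) ≡ false → ¬ (T ∖ (e , j)) (e , k)
      missing Tek (Tek′ , _) = not-¬ Tek′ Tek
      cut : ∃[ k ] T (e , k) ≡ false → ⊥
      cut (k , Tek) with <-cmp j k
      ... | tri< j<k _ _ = n≮n (toℕ j) (proj₁ (trapped e j k removed (missing Tek) _ _ W (<⇒≤ (toℕ<n j)) ≤-refl j<k))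
      ... | tri≈ _ refl _ = not-¬ Tej Tek
      ... | tri> _ _ k<j = n≮n (toℕ j) (proj₂ (trapped e k j (missing Tek) removed _ _ (reverseʷ W) (toℕ<n j) k<j ≤-refl))

  IsForest-metricGraph⇔ : ∀ T → IsForest Gλ T ⇔ IsForest G (fullEdges len T)
  IsForest-metricGraph⇔ T = mk⇔ (λ forest → forest ∘ HasCycle-subdivide T) (λ forest → forest ∘ HasCycle-project T)

proposition3p12 :
    (n m : ℕ) (en : Fin m → Fin n × Fin n) (len : Fin m → ℕ) →
    (∀ e → 1 ≤ len e) →
    (S : Σ (Fin m) (λ e → Fin (len e)) → Bool) →
    MetricBasis (CycleMatroidBasis (finGraph n m en)) len S
      ⇔ CycleMatroidBasis (metricGraph (finGraph n m en) len) S
proposition3p12 n m en len len≥1 S =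
  ⇔.trans (metricBasis⇔maximal S) (Maximal-cong (λ T → ⇔.sym (IsForest-metricGraph⇔ T)) S)
  where
    G = finGraph n m en
    open MetricMatroid _≟ᶠ_ len (IsForest G) IsForest-antitone
    open MetricGraph G _≟ᶠ_ len len≥1
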